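{- Let $G$ be a graph of order $n\ge 2$ and let $H$ be a graph with at least two vertices and a distinguished root vertex $v$. Then $$\gamma(G\circ H)\in \{\,n\gamma(H),\ n(\gamma(H)-1)+\gamma(G)\,\}.$$
   Context: All graphs are finite, simple and undirected. A set $D$ of vertices of a graph $G$ is dominating if every vertex not in $D$ has a neighbor in $D$; $\gamma(G)$ is the minimum cardinality of a dominating set. For a graph $G$ with vertex set $\{v_1,\dots,v_n\}$ and a graph $H$ with root vertex $v$, the rooted product $G\circ H$ is the graph obtained by taking one copy of $G$ and $n$ copies $H_1,\dots,H_n$ of $H$ and identifying, for each $i$, the vertex $v_i$ of $G$ with the copy of the root $v$ in $H_i$. -}

module Defs where

open import Level using (0ℓ)
open import Data.Nat using (ℕ; _*_)
open import Data.Fin using (Fin; remQuot)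
open import Data.Fin.Subset using (Subset; _∈_; ∣_∣)
open import Data.Product using (_×_; Σ; ∃; _,_; proj₁; proj₂)
open import Data.Sum using (_⊎_)
open import Relation.Nullary using (¬_)
open import Relation.Binary.PropositionalEquality using (_≡_)

record Graph : Set₁ where
  field
    order : ℕ
    Adj   : Fin order → Fin order → Set
    sym   : ∀ {u v} → Adj u v → Adj v u
    irrefl : ∀ {u} → ¬ Adj u u
open Graph public

Dominating : (G : Graph) → Subset (order G) → Set
Dominating G D = ∀ v → ¬ (v ∈ D) → ∃ λ u → u ∈ D × Adj G u v

IsDominationNumber : Graph → ℕ → Set
IsDominationNumber G k =
  (Σ (Subset (order G)) λ D → Dominating G D × ∣ D ∣ ≡ k)
  × (∀ D → Dominating G D → k Data.Nat.≤ ∣ D ∣)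

-- Vertex (i , a) with i a vertex
-- of G and a a vertex of H (the copy H_i) is encoded as an element of
-- Fin (order G * order H) via remQuot / combine. The vertex v_i of G is
-- identified with (i , r).
RPAdj : (G H : Graph) → Fin (order H) → Fin (order G) × Fin (order H)
      → Fin (order G) × Fin (order H) → Set
RPAdj G H r (i , a) (j , b) =
  (i ≡ j × Adj H a b) ⊎ (a ≡ r × b ≡ r × Adj G i j)

rootedProduct : (G H : Graph) → Fin (order H) → Graph
rootedProduct G H r = record
  { order = order G * order H
  ; Adj = λ x y → RPAdj G H r (remQuot (order H) x) (remQuot (order H) y)
  ; sym = λ { (Data.Sum.inj₁ (e , h)) → Data.Sum.inj₁ (Relation.Binary.PropositionalEquality.sym e , Graph.sym H h)
            ; (Data.Sum.inj₂ (p , q , g)) → Data.Sum.inj₂ (q , p , Graph.sym G g) }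
  ; irrefl = λ { (Data.Sum.inj₁ (_ , h)) → Graph.irrefl H h
               ; (Data.Sum.inj₂ (_ , _ , g)) → Graph.irrefl G g }
  }

module Submission where

-- A vertex set of G ∘ H is the same thing as a family of "slices"
-- S₀ … Sₙ₋₁ ⊆ V(H), one per copy of H.  A non-root vertex of copy i can only
-- be dominated from inside copy i, so every slice of a dominating set
-- dominates H except possibly at r.  Hence each slice has size ≥ γ(H) − 1,
-- and size ≥ γ(H) as soon as r is covered inside its own copy.  Take a
-- minimum dominating set of G ∘ H and split on its slices:
--  * all slices have size ≥ γ(H): then γ(G ∘ H) ≥ n·γ(H), while n copies of
--    a minimum dominating set of H show γ(G ∘ H) ≤ n·γ(H);
--  * some slice S has |S| < γ(H): the copies whose slice has size ≥ γ(H) form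
--    a dominating set A of G (an uncovered root must be dominated from the
--    root of an adjacent copy), so γ(G ∘ H) ≥ n·(γ(H) − 1) + |A|; conversely
--    S in every copy plus the roots over a minimum dominating set of G
--    dominates G ∘ H, giving γ(G ∘ H) ≤ n·(γ(H) − 1) + γ(G).

open import Defs hiding (sym)
open import Data.Nat using (ℕ; zero; suc; _*_; _+_; _∸_; _≤_; _<_; _≤?_; z≤n; s≤s)
open import Data.Nat.Properties
  using (≤-trans; ≤-antisym; ≤-reflexive; +-mono-≤; +-monoˡ-≤; +-monoʳ-≤;
         *-monoʳ-≤; +-suc; +-identityʳ; n≤1+n; ≰⇒>; ∸-monoˡ-≤; m+n∸n≡m; m∸n+n≡m;
         +-commutativeSemigroup; module ≤-Reasoning)
open import Algebra.Properties.CommutativeSemigroup +-commutativeSemigroup using (interchange)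
open import Data.Bool using (Bool; true; false)
open import Data.Fin using (Fin; zero; suc; combine; remQuot; _≟_)
open import Data.Fin.Properties using (remQuot-combine; combine-remQuot; all?; ¬∀⟶∃¬)
open import Data.Fin.Subset using (Subset; inside; outside; _∈_; _∉_; _⊆_; _∪_; ⁅_⁆; ∣_∣)
open import Data.Fin.Subset.Properties using (x∈p∪q⁺; p⊆p∪q; x∈⁅x⁆; ∣⁅x⁆∣≡1)
open import Data.Vec using (_∷_; []; _++_; concat; lookup; tabulate; group)
open import Data.Vec.Properties
  using ([]=⇒lookup; lookup⇒[]=; lookup∘tabulate; tabulate∘lookup; lookup-concat)
open import Data.Product using (_×_; ∃; ∃₂; _,_; proj₁; proj₂)
open import Data.Sum using (_⊎_; inj₁; inj₂)
open import Data.Empty using (⊥-elim)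
open import Function using (_∘_)
open import Relation.Nullary using (¬_; Dec; yes; no; does)
open import Relation.Unary using (Pred; Decidable)
open import Relation.Binary.PropositionalEquality
  using (_≡_; _≢_; refl; sym; trans; cong; cong₂; subst)

∑ : ∀ {m} → (Fin m → ℕ) → ℕ
∑ {zero}  f = 0
∑ {suc m} f = f zero + ∑ (f ∘ suc)

∑-mono : ∀ {m} {f g : Fin m → ℕ} → (∀ i → f i ≤ g i) → ∑ f ≤ ∑ g
∑-mono {zero}  f≤g = z≤n
∑-mono {suc m} f≤g = +-mono-≤ (f≤g zero) (∑-mono (f≤g ∘ suc))

∑-+ : ∀ {m} (f g : Fin m → ℕ) → ∑ (λ i → f i + g i) ≡ ∑ f + ∑ g
∑-+ {zero}  f g = refl
∑-+ {suc m} f g = trans (cong (f zero + g zero +_) (∑-+ (f ∘ suc) (g ∘ suc)))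
                        (interchange (f zero) (g zero) (∑ (f ∘ suc)) (∑ (g ∘ suc)))

∑-const : ∀ m c → ∑ {m} (λ _ → c) ≡ m * c
∑-const zero    c = refl
∑-const (suc m) c = cong (c +_) (∑-const m c)

∑-≥-const : ∀ {m c} {f : Fin m → ℕ} → (∀ i → c ≤ f i) → m * c ≤ ∑ f
∑-≥-const {m} {c} c≤f = ≤-trans (≤-reflexive (sym (∑-const m c))) (∑-mono c≤f)

χ : Bool → ℕ
χ true  = 1
χ false = 0

∣tabulate∣ : ∀ {m} (f : Fin m → Bool) → ∣ tabulate f ∣ ≡ ∑ (χ ∘ f)
∣tabulate∣ {zero}  f = refl
∣tabulate∣ {suc m} f with f zero
... | true  = cong suc (∣tabulate∣ (f ∘ suc))
... | false = ∣tabulate∣ (f ∘ suc)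

∣p∣≡∑χ : ∀ {m} (p : Subset m) → ∣ p ∣ ≡ ∑ (χ ∘ lookup p)
∣p∣≡∑χ p = trans (cong ∣_∣ (sym (tabulate∘lookup p))) (∣tabulate∣ (lookup p))

∣p++q∣ : ∀ {m l} (p : Subset m) (q : Subset l) → ∣ p ++ q ∣ ≡ ∣ p ∣ + ∣ q ∣
∣p++q∣ []            q = refl
∣p++q∣ (inside  ∷ p) q = cong suc (∣p++q∣ p q)
∣p++q∣ (outside ∷ p) q = ∣p++q∣ p q

∣p∪q∣≤∣p∣+∣q∣ : ∀ {m} (p q : Subset m) → ∣ p ∪ q ∣ ≤ ∣ p ∣ + ∣ q ∣
∣p∪q∣≤∣p∣+∣q∣ []            []            = z≤n
∣p∪q∣≤∣p∣+∣q∣ (outside ∷ p) (outside ∷ q) = ∣p∪q∣≤∣p∣+∣q∣ p q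
∣p∪q∣≤∣p∣+∣q∣ (outside ∷ p) (inside  ∷ q) =
  ≤-trans (s≤s (∣p∪q∣≤∣p∣+∣q∣ p q)) (≤-reflexive (sym (+-suc ∣ p ∣ ∣ q ∣)))
∣p∪q∣≤∣p∣+∣q∣ (inside  ∷ p) (outside ∷ q) = s≤s (∣p∪q∣≤∣p∣+∣q∣ p q)
∣p∪q∣≤∣p∣+∣q∣ (inside  ∷ p) (inside  ∷ q) =
  s≤s (≤-trans (∣p∪q∣≤∣p∣+∣q∣ p q) (+-monoʳ-≤ ∣ p ∣ (n≤1+n ∣ q ∣)))

∣p∪⁅x⁆∣≤∣p∣+1 : ∀ {m} (p : Subset m) x → ∣ p ∪ ⁅ x ⁆ ∣ ≤ ∣ p ∣ + 1
∣p∪⁅x⁆∣≤∣p∣+1 p x = ≤-trans (∣p∪q∣≤∣p∣+∣q∣ p ⁅ x ⁆) (≤-reflexive (cong (∣ p ∣ +_) (∣⁅x⁆∣≡1 x)))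

select : ∀ {m ℓ} {P : Pred (Fin m) ℓ} → Decidable P → Subset m
select P? = tabulate (λ i → does (P? i))

∈-select⁺ : ∀ {m ℓ} {P : Pred (Fin m) ℓ} (P? : Decidable P) {i} → P i → i ∈ select P?
∈-select⁺ P? {i} Pi with P? i in eq
... | yes _  = lookup⇒[]= i (select P?) (trans (lookup∘tabulate _ i) (cong does eq))
... | no ¬Pi = ⊥-elim (¬Pi Pi)

-- Fin (n * k) enumerates pairs (i , a) via combine / remQuot; a subset of it
-- is the concatenation of n subsets of Fin k, its slices.

assemble : ∀ {n k} → (Fin n → Subset k) → Subset (n * k)
assemble S = concat (tabulate S)

∣assemble∣ : ∀ {n k} (S : Fin n → Subset k) → ∣ assemble S ∣ ≡ ∑ (λ i → ∣ S i ∣)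
∣assemble∣ {zero}  S = refl
∣assemble∣ {suc n} S =
  trans (∣p++q∣ (S zero) (assemble (S ∘ suc))) (cong (∣ S zero ∣ +_) (∣assemble∣ (S ∘ suc)))

lookup-assemble : ∀ {n k} (S : Fin n → Subset k) i a →
                  lookup (assemble S) (combine i a) ≡ lookup (S i) a
lookup-assemble S i a =
  trans (lookup-concat (tabulate S) i a) (cong (λ p → lookup p a) (lookup∘tabulate S i))

∈-assemble⁺ : ∀ {n k} (S : Fin n → Subset k) {i a} → a ∈ S i → combine i a ∈ assemble S
∈-assemble⁺ S {i} {a} a∈ =
  lookup⇒[]= (combine i a) (assemble S) (trans (lookup-assemble S i a) ([]=⇒lookup a∈))

∈-assemble⁻ : ∀ {n k} (S : Fin n → Subset k) {i a} → combine i a ∈ assemble S → a ∈ S i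
∈-assemble⁻ S {i} {a} ia∈ =
  lookup⇒[]= a (S i) (trans (sym (lookup-assemble S i a)) ([]=⇒lookup ia∈))

slices : ∀ n k → Subset (n * k) → Fin n → Subset k
slices n k D = lookup (proj₁ (group n k D))

assemble-slices : ∀ n k (D : Subset (n * k)) → assemble (slices n k D) ≡ D
assemble-slices n k D =
  trans (cong concat (tabulate∘lookup (proj₁ (group n k D)))) (sym (proj₂ (group n k D)))

-- Arithmetic core of the per-copy bound: a slice of size s with γ ≤ s + 1
-- accounts for γ − 1 vertices, plus one more when it is full (γ ≤ s).
full-copy-bound : ∀ {γ s} → 1 ≤ γ → γ ≤ s + 1 → (full? : Dec (γ ≤ s)) → (γ ∸ 1) + χ (does full?) ≤ s
full-copy-bound γ≥1 _       (yes full) = ≤-trans (≤-reflexive (m∸n+n≡m γ≥1)) full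
full-copy-bound {γ} {s} _ γ≤s+1 (no _) =
  ≤-trans (≤-reflexive (+-identityʳ (γ ∸ 1)))
          (≤-trans (∸-monoˡ-≤ 1 γ≤s+1) (≤-reflexive (m+n∸n≡m s 1)))

HasNeighbourIn : (X : Graph) → Subset (order X) → Fin (order X) → Set
HasNeighbourIn X T v = ∃ λ u → u ∈ T × Adj X u v

Covers : (X : Graph) → Subset (order X) → Fin (order X) → Set
Covers X T v = v ∈ T ⊎ HasNeighbourIn X T v

DominatesExcept : (X : Graph) → Fin (order X) → Subset (order X) → Set
DominatesExcept X r T = ∀ v → v ∉ T → v ≢ r → HasNeighbourIn X T v

HasNeighbourIn-mono : ∀ X {T T′ v} → T ⊆ T′ → HasNeighbourIn X T v → HasNeighbourIn X T′ v
HasNeighbourIn-mono X T⊆T′ (u , u∈ , adj) = u , T⊆T′ u∈ , adj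

dominating-∪-root : ∀ {X r T} → DominatesExcept X r T → Dominating X (T ∪ ⁅ r ⁆)
dominating-∪-root {X} {r} dom v v∉ with v ≟ r
... | yes refl = ⊥-elim (v∉ (x∈p∪q⁺ (inj₂ (x∈⁅x⁆ r))))
... | no v≢r   = HasNeighbourIn-mono X (p⊆p∪q ⁅ r ⁆) (dom v (v∉ ∘ p⊆p∪q ⁅ r ⁆) v≢r)

dominating-if-covers : ∀ {X r T} → DominatesExcept X r T → Covers X T r → Dominating X T
dominating-if-covers {r = r} dom cover v v∉ with v ≟ r
dominating-if-covers dom (inj₁ r∈)    v v∉ | yes refl = ⊥-elim (v∉ r∈)
dominating-if-covers dom (inj₂ nbour) v v∉ | yes refl = nbour
dominating-if-covers dom cover        v v∉ | no v≢r   = dom v v∉ v≢r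

∪-root-bound : ∀ {X r T γ} → IsDominationNumber X γ → DominatesExcept X r T → γ ≤ ∣ T ∣ + 1
∪-root-bound {X} {r} {T} (_ , minimal) dom =
  ≤-trans (minimal _ (dominating-∪-root {X} dom)) (∣p∪⁅x⁆∣≤∣p∣+1 T r)

covers-bound : ∀ {X r T γ} → IsDominationNumber X γ → DominatesExcept X r T →
               Covers X T r → γ ≤ ∣ T ∣
covers-bound {X} (_ , minimal) dom cover = minimal _ (dominating-if-covers {X} dom cover)

module RootedProduct (G H : Graph) (r : Fin (order H)) where

  n k : ℕ
  n = order G
  k = order H

  GH : Graph
  GH = rootedProduct G H r

  SliceDominating : (Fin n → Subset k) → Set
  SliceDominating S =
    ∀ i a → a ∉ S i → ∃₂ λ j b → b ∈ S j × RPAdj G H r (j , b) (i , a)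

  assemble-dominating : ∀ {S} → SliceDominating S → Dominating GH (assemble S)
  assemble-dominating {S} dom v v∉ = dominator (dom i a a∉)
    where
    i : Fin n
    i = proj₁ (remQuot {n} k v)
    a : Fin k
    a = proj₂ (remQuot {n} k v)
    a∉ : a ∉ S i
    a∉ a∈ = v∉ (subst (_∈ assemble S) (combine-remQuot {n} k v) (∈-assemble⁺ S a∈))
    dominator : (∃₂ λ j b → b ∈ S j × RPAdj G H r (j , b) (i , a)) →
                HasNeighbourIn GH (assemble S) v
    dominator (j , b , b∈ , adj) =
      combine j b , ∈-assemble⁺ S b∈ ,
      subst (λ p → RPAdj G H r p (i , a)) (sym (remQuot-combine j b)) adj

  assembled-slice-dominating : ∀ {S} → Dominating GH (assemble S) → SliceDominating S
  assembled-slice-dominating {S} dom i a a∉ = slice-neighbour (dom (combine i a) (a∉ ∘ ∈-assemble⁻ S))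
    where
    slice-neighbour : HasNeighbourIn GH (assemble S) (combine i a) →
                      ∃₂ λ j b → b ∈ S j × RPAdj G H r (j , b) (i , a)
    slice-neighbour (u , u∈ , adj) =
      proj₁ (remQuot {n} k u) , proj₂ (remQuot {n} k u) ,
      ∈-assemble⁻ S (subst (_∈ assemble S) (sym (combine-remQuot {n} k u)) u∈) ,
      subst (RPAdj G H r (remQuot {n} k u)) (remQuot-combine i a) adj

  -- Inside copy i only r can be dominated from another copy.
  copy-dominatesExcept : ∀ {S} → SliceDominating S → ∀ i → DominatesExcept H r (S i)
  copy-dominatesExcept dom i a a∉ a≢r with dom i a a∉
  ... | j , b , b∈ , inj₁ (refl , adj)   = b , b∈ , adj
  ... | j , b , b∈ , inj₂ (_ , a≡r , _) = ⊥-elim (a≢r a≡r)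

  root-from-adjacent-copy : ∀ {S} → SliceDominating S → ∀ i → ¬ Covers H (S i) r →
                            ∃ λ j → r ∈ S j × Adj G j i
  root-from-adjacent-copy dom i uncovered with dom i r (uncovered ∘ inj₁)
  ... | j , b , b∈ , inj₁ (refl , adj)      = ⊥-elim (uncovered (inj₂ (b , b∈ , adj)))
  ... | j , b , b∈ , inj₂ (refl , _ , adjG) = j , b∈ , adjG

  product-bound : ∀ {γ S} → IsDominationNumber GH γ → SliceDominating S → γ ≤ ∑ (λ i → ∣ S i ∣)
  product-bound {S = S} (_ , minimal) dom =
    ≤-trans (minimal _ (assemble-dominating dom)) (≤-reflexive (∣assemble∣ S))

  copies-dominating : ∀ {T} → Dominating H T → SliceDominating (λ _ → T)
  copies-dominating dom i a a∉ =
    let (b , b∈ , adj) = dom a a∉ in i , b , b∈ , inj₁ (refl , adj)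

  upper-uniform : ∀ {γH γ} → IsDominationNumber H γH → IsDominationNumber GH γ → γ ≤ n * γH
  upper-uniform ((T , T-dom , ∣T∣≡γH) , _) dGH =
    ≤-trans (product-bound dGH (copies-dominating T-dom))
            (≤-reflexive (trans (∑-const n ∣ T ∣) (cong (n *_) ∣T∣≡γH)))

  -- Upper bound n·|T| + γ(G): T in every copy, plus the roots of the copies
  -- over a dominating set C of G.
  addRoot : Bool → Subset k → Subset k
  addRoot true  T = T ∪ ⁅ r ⁆
  addRoot false T = T

  ∣addRoot∣ : ∀ b T → ∣ addRoot b T ∣ ≤ ∣ T ∣ + χ b
  ∣addRoot∣ true  T = ∣p∪⁅x⁆∣≤∣p∣+1 T r
  ∣addRoot∣ false T = ≤-reflexive (sym (+-identityʳ ∣ T ∣))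

  ⊆-addRoot : ∀ b T → T ⊆ addRoot b T
  ⊆-addRoot true  T = p⊆p∪q ⁅ r ⁆
  ⊆-addRoot false T = λ a∈ → a∈

  root∈addRoot : ∀ {C : Subset n} {i} T → i ∈ C → r ∈ addRoot (lookup C i) T
  root∈addRoot T i∈C rewrite []=⇒lookup i∈C = x∈p∪q⁺ (inj₂ (x∈⁅x⁆ r))

  copies-with-roots-dominating : ∀ {T C} → DominatesExcept H r T → Dominating G C →
                                 SliceDominating (λ i → addRoot (lookup C i) T)
  copies-with-roots-dominating {T} {C} T-dom C-dom i a a∉ with a ≟ r
  ... | no a≢r =
    let (b , b∈ , adj) = T-dom a (a∉ ∘ ⊆-addRoot (lookup C i) T) a≢r
    in i , b , ⊆-addRoot (lookup C i) T b∈ , inj₁ (refl , adj)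
  ... | yes refl =
    let (j , j∈C , adjG) = C-dom i (a∉ ∘ root∈addRoot T)
    in j , r , root∈addRoot T j∈C , inj₂ (refl , refl , adjG)

  upper-mixed : ∀ {γG γ T} → IsDominationNumber G γG → IsDominationNumber GH γ →
                DominatesExcept H r T → γ ≤ n * ∣ T ∣ + γG
  upper-mixed {γG} {γ} {T} ((C , C-dom , ∣C∣≡γG) , _) dGH T-dom = begin
    γ                                        ≤⟨ product-bound dGH (copies-with-roots-dominating T-dom C-dom) ⟩
    ∑ (λ i → ∣ addRoot (lookup C i) T ∣)      ≤⟨ ∑-mono (λ i → ∣addRoot∣ (lookup C i) T) ⟩
    ∑ (λ i → ∣ T ∣ + χ (lookup C i))          ≡⟨ ∑-+ (λ _ → ∣ T ∣) (χ ∘ lookup C) ⟩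
    ∑ {n} (λ _ → ∣ T ∣) + ∑ (χ ∘ lookup C)    ≡⟨ cong₂ _+_ (∑-const n ∣ T ∣) (sym (∣p∣≡∑χ C)) ⟩
    n * ∣ T ∣ + ∣ C ∣                          ≡⟨ cong (n * ∣ T ∣ +_) ∣C∣≡γG ⟩
    n * ∣ T ∣ + γG                             ∎
    where open ≤-Reasoning

  -- Lower bound: the copies with a full slice dominate G.
  lower-mixed : ∀ {γG γH S} → IsDominationNumber G γG → IsDominationNumber H γH →
                1 ≤ γH → SliceDominating S → n * (γH ∸ 1) + γG ≤ ∑ (λ i → ∣ S i ∣)
  lower-mixed {γG} {γH} {S} (_ , minimalG) dH γH≥1 dom = begin
    n * (γH ∸ 1) + γG                                ≤⟨ +-monoʳ-≤ (n * (γH ∸ 1)) (minimalG A A-dominating) ⟩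
    n * (γH ∸ 1) + ∣ A ∣                              ≡⟨ cong₂ _+_ (sym (∑-const n (γH ∸ 1))) (∣tabulate∣ (does ∘ full?)) ⟩
    ∑ {n} (λ _ → γH ∸ 1) + ∑ (λ i → χ (does (full? i))) ≡⟨ sym (∑-+ (λ _ → γH ∸ 1) (χ ∘ does ∘ full?)) ⟩
    ∑ (λ i → (γH ∸ 1) + χ (does (full? i)))          ≤⟨ ∑-mono per-copy ⟩
    ∑ (λ i → ∣ S i ∣)                                 ∎
    where
    open ≤-Reasoning
    full? : Decidable (λ i → γH ≤ ∣ S i ∣)
    full? i = γH ≤? ∣ S i ∣
    A : Subset n
    A = select full?
    covered-full : ∀ {i} → Covers H (S i) r → i ∈ A
    covered-full {i} cover = ∈-select⁺ full? (covers-bound {H} dH (copy-dominatesExcept dom i) cover)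
    A-dominating : Dominating G A
    A-dominating i i∉ =
      let (j , r∈ , adjG) = root-from-adjacent-copy dom i (i∉ ∘ covered-full)
      in j , covered-full (inj₁ r∈) , adjG
    per-copy : ∀ i → (γH ∸ 1) + χ (does (full? i)) ≤ ∣ S i ∣
    per-copy i = full-copy-bound γH≥1 (∪-root-bound {H} dH (copy-dominatesExcept dom i)) (full? i)

mainTheorem1 : (G H : Graph) (r : Fin (order H)) →
    2 ≤ order G → 2 ≤ order H →
    (γG γH γGH : ℕ) →
    IsDominationNumber G γG → IsDominationNumber H γH →
    IsDominationNumber (rootedProduct G H r) γGH →
    (γGH ≡ order G * γH) ⊎ (γGH ≡ order G * (γH ∸ 1) + γG)
mainTheorem1 G H r _ _ γG γH γGH dG dH dGH@((D , D-dom , ∣D∣≡γGH) , _) =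
  dichotomy (all? (λ i → γH ≤? ∣ S i ∣))
  where
  open RootedProduct G H r
  S : Fin n → Subset k
  S = slices n k D
  S-dom : SliceDominating S
  S-dom = assembled-slice-dominating (subst (Dominating GH) (sym (assemble-slices n k D)) D-dom)
  γGH≡∑ : γGH ≡ ∑ (λ i → ∣ S i ∣)
  γGH≡∑ = trans (sym ∣D∣≡γGH) (trans (cong ∣_∣ (sym (assemble-slices n k D))) (∣assemble∣ S))
  dichotomy : Dec (∀ i → γH ≤ ∣ S i ∣) → (γGH ≡ n * γH) ⊎ (γGH ≡ n * (γH ∸ 1) + γG)
  dichotomy (yes all-full) =
    inj₁ (≤-antisym (upper-uniform dH dGH) (≤-trans (∑-≥-const all-full) (≤-reflexive (sym γGH≡∑))))
  dichotomy (no ¬all-full) =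
    let (i₀ , ¬full) = ¬∀⟶∃¬ n _ (λ i → γH ≤? ∣ S i ∣) ¬all-full
        small : ∣ S i₀ ∣ < γH
        small = ≰⇒> ¬full
    in inj₂ (≤-antisym
         (≤-trans (upper-mixed dG dGH (copy-dominatesExcept S-dom i₀))
                  (+-monoˡ-≤ γG (*-monoʳ-≤ n (∸-monoˡ-≤ 1 small))))
         (≤-trans (lower-mixed dG dH (≤-trans (s≤s z≤n) small) S-dom) (≤-reflexive (sym γGH≡∑))))
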